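{- Let $V$ be a finite set with $n=|V|$, $d$ a nonnegative integer, and $f:2^V\to\{0,1,\dots,d\}$ a posimodular function with $f(\emptyset)=0$. Then every maximal maximizer $S$ of $f$ satisfies $|S|\ge n-d$.
   Context: A set function $f:2^V\to\mathbb{R}$ is posimodular if $f(X)+f(Y)\ge f(X\setminus Y)+f(Y\setminus X)$ for all $X,Y\subseteq V$. A maximizer of $f$ is a subset $S\subseteq V$ with $f(S)=\max\{f(X)\mid X\subseteq V\}$; it is a maximal maximizer if no proper superset of $S$ is a maximizer of $f$. -}

module Defs where

open import Data.Nat using (ℕ; _+_; _≤_; _≥_)
open import Data.Fin.Subset using (Subset; _─_; _⊂_)
open import Data.Product using (_×_)
open import Relation.Binary.PropositionalEquality using (_≡_)
open import Relation.Nullary using (¬_)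

Posimodular : ∀ {n} → (Subset n → ℕ) → Set
Posimodular f = ∀ X Y → f X + f Y ≥ f (X ─ Y) + f (Y ─ X)

IsMaximizer : ∀ {n} → (Subset n → ℕ) → Subset n → Set
IsMaximizer f S = ∀ X → f X ≤ f S

IsMaximalMaximizer : ∀ {n} → (Subset n → ℕ) → Subset n → Set
IsMaximalMaximizer f S = IsMaximizer f S × (∀ T → S ⊂ T → ¬ IsMaximizer f T)

-- Adding any v ∉ S strictly decreases f, so for
-- every B disjoint from S and v ∈ B, posimodularity applied to S ∪ {v} and B
-- gives f (B - v) < f B: the two differences are exactly S and B - v. Peeling
-- the elements of B off one at a time yields ∣ B ∣ ≤ f B, and B = V \ S gives
-- n - ∣ S ∣ ≤ f (V \ S) ≤ d.
module Submission where

open import Defs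
open import Data.Nat using (ℕ; _+_; _≤_; _≥_; _∸_)
open import Data.Fin.Subset using (Subset; ⊥; ∣_∣)
open import Relation.Binary.PropositionalEquality using (_≡_)

open import Data.Nat using (zero; suc; z≤n; s≤s; _<_; _≤?_)
open import Data.Nat.Properties
  using (≤-trans; <-≤-trans; ≰⇒>; +-monoˡ-<; +-cancelˡ-<; suc-injective;
         ∸-monoʳ-≤; m∸[m∸n]≡n)
open import Data.Fin using (Fin)
open import Data.Fin.Subset
  using (_∪_; _─_; _-_; ⁅_⁆; ∁; _∈_; _∉_; _⊆_; _⊂_; inside; outside)
open import Data.Fin.Subset.Properties
  using (⊆-refl; ⊆-antisym; ⊆-trans; p⊆p∪q; x∈p∪q⁺; x∈p∪q⁻; x∈⁅x⁆; x∈⁅y⁆⇒x≡y;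
         x∈p∧x∉q⇒x∈p─q; p─q⊆p; p─q─r≡p─q∪r; p─⊥≡p; x∈∁p⇒x∉p;
         nonempty?; Empty-unique; ∣⊥∣≡0; ∣p∣≤n; ∣∁p∣≡n∸∣p∣)
open import Data.Vec using (_∷_; here; there)
open import Data.Product using (_,_; proj₁; proj₂)
open import Data.Sum using (inj₁; inj₂)
open import Relation.Binary.PropositionalEquality
  using (refl; sym; trans; cong; subst; subst₂; module ≡-Reasoning)
open import Relation.Nullary using (yes; no; contradiction)

private
  variable
    n : ℕ
    x : Fin n
    p q r : Subset n

x∈p─q⇒x∉q : x ∈ p ─ q → x ∉ q
x∈p─q⇒x∉q {p = inside ∷ _} {q = inside ∷ _} () here
x∈p─q⇒x∉q {p = _ ∷ _} {q = _ ∷ _} (there x∈p─q) (there x∈q) = x∈p─q⇒x∉q x∈p─q x∈q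

p⊆∁q⇒p─q≡p : p ⊆ ∁ q → p ─ q ≡ p
p⊆∁q⇒p─q≡p {p = p} {q = q} p⊆∁q = ⊆-antisym (p─q⊆p p q)
  (λ x∈p → x∈p∧x∉q⇒x∈p─q x∈p (x∈∁p⇒x∉p (p⊆∁q x∈p)))

q⊆r⊆∁p⇒p∪q─r≡p : q ⊆ r → r ⊆ ∁ p → p ∪ q ─ r ≡ p
q⊆r⊆∁p⇒p∪q─r≡p {q = q} {r = r} {p = p} q⊆r r⊆∁p = ⊆-antisym ⊆p p⊆
  where
  ⊆p : p ∪ q ─ r ⊆ p
  ⊆p x∈ with x∈p∪q⁻ p q (p─q⊆p (p ∪ q) r x∈)
  ... | inj₁ x∈p = x∈p
  ... | inj₂ x∈q = contradiction (q⊆r x∈q) (x∈p─q⇒x∉q x∈)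
  p⊆ : p ⊆ p ∪ q ─ r
  p⊆ x∈p = x∈p∧x∉q⇒x∈p─q (p⊆p∪q q x∈p) (λ x∈r → x∈∁p⇒x∉p (r⊆∁p x∈r) x∈p)

∣p∣≡1+∣p-x∣ : x ∈ p → ∣ p ∣ ≡ suc ∣ p - x ∣
∣p∣≡1+∣p-x∣ {p = inside ∷ p} here = cong (λ s → suc ∣ s ∣) (sym (p─⊥≡p p))
∣p∣≡1+∣p-x∣ {p = outside ∷ _} (there x∈p) = ∣p∣≡1+∣p-x∣ x∈p
∣p∣≡1+∣p-x∣ {p = inside  ∷ _} (there x∈p) = cong suc (∣p∣≡1+∣p-x∣ x∈p)

x∉p⇒p⊂p∪⁅x⁆ : x ∉ p → p ⊂ p ∪ ⁅ x ⁆
x∉p⇒p⊂p∪⁅x⁆ {x = x} x∉p = p⊆p∪q ⁅ x ⁆ , x , x∈p∪q⁺ (inj₂ (x∈⁅x⁆ x)) , x∉p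

module _ {n : ℕ} (f : Subset n → ℕ) {S : Subset n} (S-max : IsMaximalMaximizer f S) where

  maximalMaximizer-⊂⇒< : ∀ {T} → S ⊂ T → f T < f S
  maximalMaximizer-⊂⇒< {T} S⊂T with f S ≤? f T
  ... | no  fS≰fT = ≰⇒> fS≰fT
  ... | yes fS≤fT = contradiction (λ X → ≤-trans (proj₁ S-max X) fS≤fT) (proj₂ S-max T S⊂T)

  module _ (posimodular : Posimodular f) where

    f[B-v]<f[B] : ∀ {B v} → B ⊆ ∁ S → v ∈ B → f (B - v) < f B
    f[B-v]<f[B] {B} {v} B⊆∁S v∈B =
      +-cancelˡ-< (f X) _ _ (<-≤-trans (+-monoˡ-< (f (B - v)) fX<fS) exchange)
      where
      X : Subset n
      X = S ∪ ⁅ v ⁆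
      fX<fS : f X < f S
      fX<fS = maximalMaximizer-⊂⇒< (x∉p⇒p⊂p∪⁅x⁆ (x∈∁p⇒x∉p (B⊆∁S v∈B)))
      X─B≡S : X ─ B ≡ S
      X─B≡S = q⊆r⊆∁p⇒p∪q─r≡p (λ x∈⁅v⁆ → subst (_∈ B) (sym (x∈⁅y⁆⇒x≡y v x∈⁅v⁆)) v∈B) B⊆∁S
      B─X≡B-v : B ─ X ≡ B - v
      B─X≡B-v = begin
        B ─ (S ∪ ⁅ v ⁆) ≡⟨ sym (p─q─r≡p─q∪r B S ⁅ v ⁆) ⟩
        B ─ S - v       ≡⟨ cong (_- v) (p⊆∁q⇒p─q≡p B⊆∁S) ⟩
        B - v           ∎
        where open ≡-Reasoning
      exchange : f S + f (B - v) ≤ f X + f B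
      exchange = subst₂ (λ Y Z → f Y + f Z ≤ f X + f B) X─B≡S B─X≡B-v (posimodular X B)

    ∣B∣≤f[B] : ∀ {B} → B ⊆ ∁ S → ∣ B ∣ ≤ f B
    ∣B∣≤f[B] {B} B⊆∁S = go ∣ B ∣ B refl B⊆∁S
      where
      go : ∀ k B → ∣ B ∣ ≡ k → B ⊆ ∁ S → k ≤ f B
      go zero    B _ _ = z≤n
      go (suc k) B ∣B∣≡1+k B⊆∁S with nonempty? B
      ... | yes (v , v∈B) =
        <-≤-trans (s≤s (go k (B - v) ∣B-v∣≡k (⊆-trans (p─q⊆p B ⁅ v ⁆) B⊆∁S)))
                  (f[B-v]<f[B] B⊆∁S v∈B)
        where
        ∣B-v∣≡k : ∣ B - v ∣ ≡ k
        ∣B-v∣≡k = suc-injective (trans (sym (∣p∣≡1+∣p-x∣ v∈B)) ∣B∣≡1+k)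
      ... | no B-empty = contradiction (trans (sym ∣B∣≡1+k) ∣B∣≡0) λ ()
        where
        ∣B∣≡0 : ∣ B ∣ ≡ 0
        ∣B∣≡0 = trans (cong ∣_∣ (Empty-unique B-empty)) (∣⊥∣≡0 n)

-- The hypothesis f ⊥ ≡ 0 is not needed: f takes values in ℕ, so f ⊥ ≥ 0 suffices.
corollary3 : (n d : ℕ) (f : Subset n → ℕ) →
    (∀ X → f X ≤ d) → Posimodular f → f ⊥ ≡ 0 →
    (S : Subset n) → IsMaximalMaximizer f S → ∣ S ∣ ≥ n ∸ d
corollary3 n d f f≤d posimodular _ S S-max = begin
  n ∸ d           ≤⟨ ∸-monoʳ-≤ n n∸∣S∣≤d ⟩
  n ∸ (n ∸ ∣ S ∣) ≡⟨ m∸[m∸n]≡n (∣p∣≤n S) ⟩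
  ∣ S ∣           ∎
  where
  open Data.Nat.Properties.≤-Reasoning
  n∸∣S∣≤d : n ∸ ∣ S ∣ ≤ d
  n∸∣S∣≤d = begin
    n ∸ ∣ S ∣  ≡⟨ sym (∣∁p∣≡n∸∣p∣ S) ⟩
    ∣ ∁ S ∣    ≤⟨ ∣B∣≤f[B] f S-max posimodular ⊆-refl ⟩
    f (∁ S)    ≤⟨ f≤d (∁ S) ⟩
    d          ∎
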